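{- Every $\Delta_0$-formula $\varphi$ of $\mathbb T$ (in context $\bar x$) has a complement in $\mathbb T$ which is itself a $\Delta_0$-formula; i.e. there is a $\Delta_0$-formula $\psi$ with $\mathbb T$ proving $\varphi\wedge\psi\vdash_{\bar x}\bot$ and $\top\vdash_{\bar x}\varphi\vee\psi$.
   Context: Coherent logic: formulas built from atomic formulas (including equalities) using only $\top,\bot,\wedge,\vee,\exists$; sequents $\varphi\vdash_{\bar x}\psi$ derived with the standard coherent deduction system. PrimRec is the set of primitive recursive function descriptions generated from $\mathsf z$ (constant $0$), $\mathsf s$ (successor), projections $\pi^n_k$, composition $\mathrm{Cn}[\mathsf h,\mathsf g_1,\dots,\mathsf g_n]$ and primitive recursion $\mathrm{Pr}[\mathsf g,\mathsf h]$. The coherent arithmetic $\mathbb T$ has a constant $\mathsf 0$, a function symbol for each element of PrimRec, and a binary predicate $<$, with axioms: $\mathsf zx=\mathsf 0$; $\pi^n_k(x_1,\dots,x_n)=x_k$; $\mathsf sx=\mathsf 0\vdash\bot$; $\mathsf sx=\mathsf sy\vdash x=y$; the defining equations of each composition and primitive recursion symbol; $x<y\dashv\vdash\exists z(x+\mathsf sz=y)$ with $+$ the PrimRec addition. Formulas may also use bounded universal quantifiers $\forall z<t\,\varphi$ ($t$ not containing $z$) with the double rule $\psi\vdash\forall z<t\,\varphi$ iff $\psi\wedge z<t\vdash\varphi$ ($z$ not free in $\psi$), and $\mathbb T$ has the induction rules (IndR) and (IndL): from $\psi(\bar x)\vdash\varphi(\bar x,\mathsf 0)$ and $\psi(\bar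 x)\wedge\varphi(\bar x,y)\vdash\varphi(\bar x,\mathsf sy)$ infer $\psi(\bar x)\vdash_{\bar x,y}\varphi(\bar x,y)$; from $\psi(\bar x,\mathsf 0)\vdash\varphi(\bar x)$ and $\psi(\bar x,\mathsf sy)\vdash\varphi(\bar x)\vee\psi(\bar x,y)$ infer $\psi(\bar x,y)\vdash_{\bar x,y}\varphi(\bar x)$. A $\Delta_0$-formula of $\mathbb T$ is one built from atomic formulas using $\top,\bot,\wedge,\vee$ and bounded quantifiers $\exists z(z<t\wedge\cdot)$ and $\forall z<t$ only (no unbounded $\exists$). -}

module Defs where

open import Data.Nat using (ℕ; zero; suc)
open import Data.Fin using (Fin; zero; suc)
open import Data.Vec using (Vec; []; _∷_; _∷ʳ_; tabulate; map)
open import Function using (_∘_)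

data PR : ℕ → Set where
  𝗓  : PR 1
  𝗌  : PR 1
  π  : (n : ℕ) → Fin n → PR n
  Cn : ∀ {m n} → PR m → Vec (PR n) m → PR n
  Pr : ∀ {n} → PR n → PR (suc (suc n)) → PR (suc n)

-- PrimRec addition: add(x,0)=x, add(x,sy)=s(add(x,y))
add : PR 2
add = Pr (π 1 zero) (Cn 𝗌 (π 3 (suc (suc zero)) ∷ []))

-- Terms and formulas in a context of n variables (de Bruijn; var zero is
-- the most recently bound / last variable of the context).

data Term (n : ℕ) : Set where
  var : Fin n → Term n
  𝟎   : Term n
  app : ∀ {k} → PR k → Vec (Term n) k → Term n

infix  6 _≐_ _<ᶠ_
infixr 5 _∧ᶠ_
infixr 4 _∨ᶠ_

data Formula (n : ℕ) : Set where
  ⊤ᶠ ⊥ᶠ : Formula n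
  _≐_  : Term n → Term n → Formula n
  _<ᶠ_ : Term n → Term n → Formula n
  _∧ᶠ_ _∨ᶠ_ : Formula n → Formula n → Formula n
  ∃ᶠ   : Formula (suc n) → Formula n
  -- bounded universal ∀ z < t φ : t lives in context n, so z ∉ t
  ∀<ᶠ  : Term n → Formula (suc n) → Formula n

Sub : ℕ → ℕ → Set
Sub n m = Fin n → Term m

mutual
  subT : ∀ {n m} → Sub n m → Term n → Term m
  subT σ (var i)    = σ i
  subT σ 𝟎          = 𝟎
  subT σ (app f ts) = app f (subTs σ ts)

  subTs : ∀ {n m k} → Sub n m → Vec (Term n) k → Vec (Term m) k
  subTs σ []       = []
  subTs σ (t ∷ ts) = subT σ t ∷ subTs σ ts

wkT : ∀ {n} → Term n → Term (suc n)
wkT = subT (var ∘ suc)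

lift : ∀ {n m} → Sub n m → Sub (suc n) (suc m)
lift σ zero    = var zero
lift σ (suc i) = wkT (σ i)

subF : ∀ {n m} → Sub n m → Formula n → Formula m
subF σ ⊤ᶠ        = ⊤ᶠ
subF σ ⊥ᶠ        = ⊥ᶠ
subF σ (t ≐ u)   = subT σ t ≐ subT σ u
subF σ (t <ᶠ u)  = subT σ t <ᶠ subT σ u
subF σ (φ ∧ᶠ ψ)  = subF σ φ ∧ᶠ subF σ ψ
subF σ (φ ∨ᶠ ψ)  = subF σ φ ∨ᶠ subF σ ψ
subF σ (∃ᶠ φ)    = ∃ᶠ (subF (lift σ) φ)
subF σ (∀<ᶠ t φ) = ∀<ᶠ (subT σ t) (subF (lift σ) φ)

wkF : ∀ {n} → Formula n → Formula (suc n)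
wkF = subF (var ∘ suc)

_/0 : ∀ {n} → Term n → Sub (suc n) n
(t /0) zero    = t
(t /0) (suc i) = var i

S : ∀ {n} → Term n → Term n
S t = app 𝗌 (t ∷ [])

succ0 : ∀ {n} → Sub (suc n) (suc n)
succ0 zero    = S (var zero)
succ0 (suc i) = var (suc i)

∃<ᶠ : ∀ {n} → Term n → Formula (suc n) → Formula n
∃<ᶠ t φ = ∃ᶠ ((var zero <ᶠ wkT t) ∧ᶠ φ)

data Δ₀ {n : ℕ} : Formula n → Set where
  ⊤Δ  : Δ₀ ⊤ᶠ
  ⊥Δ  : Δ₀ ⊥ᶠ
  ≐Δ  : ∀ t u → Δ₀ (t ≐ u)
  <Δ  : ∀ t u → Δ₀ (t <ᶠ u)
  ∧Δ  : ∀ {φ ψ} → Δ₀ φ → Δ₀ ψ → Δ₀ (φ ∧ᶠ ψ)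
  ∨Δ  : ∀ {φ ψ} → Δ₀ φ → Δ₀ ψ → Δ₀ (φ ∨ᶠ ψ)
  ∃<Δ : ∀ t {φ} → Δ₀ φ → Δ₀ (∃<ᶠ t φ)
  ∀<Δ : ∀ t {φ} → Δ₀ φ → Δ₀ (∀<ᶠ t φ)

-- Axioms of 𝕋.  Argument order: the vector of arguments lists x_1..x_n in
-- order; in Pr[g,h](x̄, y) the recursion variable is the last argument.

vars : (n : ℕ) → Vec (Term n) n
vars n = tabulate var

-- x̄ inside context suc n (where var zero is y)
xs : (n : ℕ) → Vec (Term (suc n)) n
xs n = tabulate (var ∘ suc)

data Ax : (n : ℕ) → Formula n → Formula n → Set where
  ax-z    : Ax 1 ⊤ᶠ (app 𝗓 (var zero ∷ []) ≐ 𝟎)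
  ax-π    : ∀ n (k : Fin n) → Ax n ⊤ᶠ (app (π n k) (vars n) ≐ var k)
  ax-s0   : Ax 1 (S (var zero) ≐ 𝟎) ⊥ᶠ
  ax-sinj : Ax 2 (S (var (suc zero)) ≐ S (var zero)) (var (suc zero) ≐ var zero)
  ax-Cn   : ∀ {m} n (h : PR m) (gs : Vec (PR n) m) →
            Ax n ⊤ᶠ (app (Cn h gs) (vars n) ≐ app h (map (λ g → app g (vars n)) gs))
  ax-Pr0  : ∀ n (g : PR n) (h : PR (suc (suc n))) →
            Ax n ⊤ᶠ (app (Pr g h) (vars n ∷ʳ 𝟎) ≐ app g (vars n))
  ax-PrS  : ∀ n (g : PR n) (h : PR (suc (suc n))) →
            Ax (suc n) ⊤ᶠ
              (app (Pr g h) (xs n ∷ʳ S (var zero))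
                ≐ app h ((xs n ∷ʳ var zero) ∷ʳ app (Pr g h) (xs n ∷ʳ var zero)))
  -- x < y ⊣⊢ ∃z (x + s z = y)   (x = var 1, y = var 0 in context 2)
  ax-<⇒   : Ax 2 (var (suc zero) <ᶠ var zero)
                 (∃ᶠ (app add (var (suc (suc zero)) ∷ S (var zero) ∷ []) ≐ var (suc zero)))
  ax-⇐<   : Ax 2 (∃ᶠ (app add (var (suc (suc zero)) ∷ S (var zero) ∷ []) ≐ var (suc zero)))
                 (var (suc zero) <ᶠ var zero)

infix 2 Der
syntax Der n φ ψ = φ ⊢[ n ] ψ

data Der : (n : ℕ) → Formula n → Formula n → Set where
  idR   : ∀ {n} {φ : Formula n} → φ ⊢[ n ] φ
  substR : ∀ {n m} {φ ψ : Formula n} (σ : Sub n m) →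
           φ ⊢[ n ] ψ → subF σ φ ⊢[ m ] subF σ ψ
  cutR  : ∀ {n} {φ ψ χ : Formula n} → φ ⊢[ n ] ψ → ψ ⊢[ n ] χ → φ ⊢[ n ] χ
  eq-refl : ⊤ᶠ ⊢[ 1 ] (var {1} zero ≐ var zero)
  eq-subst : ∀ {n} (φ : Formula (suc n)) (t u : Term n) →
             (t ≐ u) ∧ᶠ subF (t /0) φ ⊢[ n ] subF (u /0) φ
  ⊤R : ∀ {n} {φ : Formula n} → φ ⊢[ n ] ⊤ᶠ
  ⊥L : ∀ {n} {φ : Formula n} → ⊥ᶠ ⊢[ n ] φ
  ∧L₁ : ∀ {n} {φ ψ : Formula n} → φ ∧ᶠ ψ ⊢[ n ] φ
  ∧L₂ : ∀ {n} {φ ψ : Formula n} → φ ∧ᶠ ψ ⊢[ n ] ψ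
  ∧R  : ∀ {n} {φ ψ χ : Formula n} → φ ⊢[ n ] ψ → φ ⊢[ n ] χ → φ ⊢[ n ] ψ ∧ᶠ χ
  ∨R₁ : ∀ {n} {φ ψ : Formula n} → φ ⊢[ n ] φ ∨ᶠ ψ
  ∨R₂ : ∀ {n} {φ ψ : Formula n} → ψ ⊢[ n ] φ ∨ᶠ ψ
  ∨L  : ∀ {n} {φ ψ χ : Formula n} → φ ⊢[ n ] χ → ψ ⊢[ n ] χ → φ ∨ᶠ ψ ⊢[ n ] χ
  ∃-down : ∀ {n} {φ : Formula (suc n)} {ψ : Formula n} →
           ∃ᶠ φ ⊢[ n ] ψ → φ ⊢[ suc n ] wkF ψ
  ∃-up   : ∀ {n} {φ : Formula (suc n)} {ψ : Formula n} →
           φ ⊢[ suc n ] wkF ψ → ∃ᶠ φ ⊢[ n ] ψ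
  dist : ∀ {n} {φ ψ χ : Formula n} →
         φ ∧ᶠ (ψ ∨ᶠ χ) ⊢[ n ] (φ ∧ᶠ ψ) ∨ᶠ (φ ∧ᶠ χ)
  frob : ∀ {n} {φ : Formula n} {ψ : Formula (suc n)} →
         φ ∧ᶠ ∃ᶠ ψ ⊢[ n ] ∃ᶠ (wkF φ ∧ᶠ ψ)
  ∀<-down : ∀ {n} {ψ : Formula n} {t : Term n} {φ : Formula (suc n)} →
            ψ ⊢[ n ] ∀<ᶠ t φ → wkF ψ ∧ᶠ (var zero <ᶠ wkT t) ⊢[ suc n ] φ
  ∀<-up   : ∀ {n} {ψ : Formula n} {t : Term n} {φ : Formula (suc n)} →
            wkF ψ ∧ᶠ (var zero <ᶠ wkT t) ⊢[ suc n ] φ → ψ ⊢[ n ] ∀<ᶠ t φ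
  IndR : ∀ {n} {ψ : Formula n} {φ : Formula (suc n)} →
         ψ ⊢[ n ] subF (𝟎 /0) φ →
         wkF ψ ∧ᶠ φ ⊢[ suc n ] subF succ0 φ →
         wkF ψ ⊢[ suc n ] φ
  IndL : ∀ {n} {ψ : Formula (suc n)} {φ : Formula n} →
         subF (𝟎 /0) ψ ⊢[ n ] φ →
         subF succ0 ψ ⊢[ suc n ] wkF φ ∨ᶠ ψ →
         ψ ⊢[ suc n ] wkF φ
  axR : ∀ {n} {φ ψ : Formula n} → Ax n φ ψ → φ ⊢[ n ] ψ

-- Complements are built by recursion on the Δ₀-formula: ⊤ and ⊥ complement
-- each other, an atom t ≐ u or t < u is complemented by the other two cases
-- of trichotomy, ∧ and ∨ are exchanged by De Morgan, and ∀ z < t φ and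
-- ∃ z < t ψ are complementary whenever φ and ψ are.  The only place where
-- the bound matters is exhaustiveness of the bounded quantifiers, proved by
-- induction on the bound: passing from t to s t either the new instance
-- φ(t) holds, extending the ∀, or ψ(t) holds and witnesses the ∃.  The
-- order facts behind trichotomy are derived from x < y ⊣⊢ ∃z (x + s z = y)
-- by the induction rules.
module Submission where

open import Defs
open import Data.Nat using (ℕ; suc)
open import Data.Fin using (zero; suc)
open import Data.Vec using (Vec; []; _∷_)
open import Data.Product using (Σ; Σ-syntax; _×_; _,_)
open import Function using (_∘_)
open import Relation.Binary.PropositionalEquality
  using (_≡_; refl; sym; trans; cong; cong₂; subst; subst₂; module ≡-Reasoning)

wk : ∀ {n} → Sub n (suc n)
wk = var ∘ suc

mutual
  subT-id : ∀ {n} {σ : Sub n n} → (∀ i → σ i ≡ var i) → ∀ t → subT σ t ≡ t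
  subT-id h (var i)    = h i
  subT-id h 𝟎          = refl
  subT-id h (app f ts) = cong (app f) (subTs-id h ts)

  subTs-id : ∀ {n k} {σ : Sub n n} → (∀ i → σ i ≡ var i) →
             (ts : Vec (Term n) k) → subTs σ ts ≡ ts
  subTs-id h []       = refl
  subTs-id h (t ∷ ts) = cong₂ _∷_ (subT-id h t) (subTs-id h ts)

lift-id : ∀ {n} {σ : Sub n n} → (∀ i → σ i ≡ var i) → ∀ i → lift σ i ≡ var i
lift-id h zero    = refl
lift-id h (suc i) = cong wkT (h i)

subF-id : ∀ {n} {σ : Sub n n} → (∀ i → σ i ≡ var i) → ∀ φ → subF σ φ ≡ φ
subF-id h ⊤ᶠ        = refl
subF-id h ⊥ᶠ        = refl
subF-id h (t ≐ u)   = cong₂ _≐_ (subT-id h t) (subT-id h u)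
subF-id h (t <ᶠ u)  = cong₂ _<ᶠ_ (subT-id h t) (subT-id h u)
subF-id h (φ ∧ᶠ ψ)  = cong₂ _∧ᶠ_ (subF-id h φ) (subF-id h ψ)
subF-id h (φ ∨ᶠ ψ)  = cong₂ _∨ᶠ_ (subF-id h φ) (subF-id h ψ)
subF-id h (∃ᶠ φ)    = cong ∃ᶠ (subF-id (lift-id h) φ)
subF-id h (∀<ᶠ t φ) = cong₂ ∀<ᶠ (subT-id h t) (subF-id (lift-id h) φ)

mutual
  subT-fuse : ∀ {a b c} {σ : Sub b c} {τ : Sub a b} {ν : Sub a c} →
              (∀ i → subT σ (τ i) ≡ ν i) → ∀ t → subT σ (subT τ t) ≡ subT ν t
  subT-fuse h (var i)    = h i
  subT-fuse h 𝟎          = refl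
  subT-fuse h (app f ts) = cong (app f) (subTs-fuse h ts)

  subTs-fuse : ∀ {a b c k} {σ : Sub b c} {τ : Sub a b} {ν : Sub a c} →
               (∀ i → subT σ (τ i) ≡ ν i) →
               (ts : Vec (Term a) k) → subTs σ (subTs τ ts) ≡ subTs ν ts
  subTs-fuse h []       = refl
  subTs-fuse h (t ∷ ts) = cong₂ _∷_ (subT-fuse h t) (subTs-fuse h ts)

lift-fuse : ∀ {a b c} {σ : Sub b c} {τ : Sub a b} {ν : Sub a c} →
            (∀ i → subT σ (τ i) ≡ ν i) → ∀ i → subT (lift σ) (lift τ i) ≡ lift ν i
lift-fuse h zero = refl
lift-fuse {σ = σ} {τ} {ν} h (suc i) = begin
  subT (lift σ) (wkT (τ i))   ≡⟨ subT-fuse (λ _ → refl) (τ i) ⟩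
  subT (wkT ∘ σ) (τ i)        ≡⟨ subT-fuse (λ _ → refl) (τ i) ⟨
  wkT (subT σ (τ i))          ≡⟨ cong wkT (h i) ⟩
  wkT (ν i)                   ∎
  where open ≡-Reasoning

subF-fuse : ∀ {a b c} {σ : Sub b c} {τ : Sub a b} {ν : Sub a c} →
            (∀ i → subT σ (τ i) ≡ ν i) → ∀ φ → subF σ (subF τ φ) ≡ subF ν φ
subF-fuse h ⊤ᶠ        = refl
subF-fuse h ⊥ᶠ        = refl
subF-fuse h (t ≐ u)   = cong₂ _≐_ (subT-fuse h t) (subT-fuse h u)
subF-fuse h (t <ᶠ u)  = cong₂ _<ᶠ_ (subT-fuse h t) (subT-fuse h u)
subF-fuse h (φ ∧ᶠ ψ)  = cong₂ _∧ᶠ_ (subF-fuse h φ) (subF-fuse h ψ)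
subF-fuse h (φ ∨ᶠ ψ)  = cong₂ _∨ᶠ_ (subF-fuse h φ) (subF-fuse h ψ)
subF-fuse h (∃ᶠ φ)    = cong ∃ᶠ (subF-fuse (lift-fuse h) φ)
subF-fuse h (∀<ᶠ t φ) = cong₂ ∀<ᶠ (subT-fuse h t) (subF-fuse (lift-fuse h) φ)

wkF₁ : ∀ {n} → Formula (suc n) → Formula (suc (suc n))
wkF₁ = subF (lift wk)

/0-wkT : ∀ {n} (a : Term n) (t : Term n) → subT (a /0) (wkT t) ≡ t
/0-wkT a t = trans (subT-fuse {ν = var} (λ _ → refl) t) (subT-id (λ _ → refl) t)

/0-wkF : ∀ {n} (a : Term n) (φ : Formula n) → subF (a /0) (wkF φ) ≡ φ
/0-wkF a φ = trans (subF-fuse {ν = var} (λ _ → refl) φ) (subF-id (λ _ → refl) φ)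

lift-/0-wkF₁ : ∀ {n} (a : Term n) (φ : Formula (suc n)) →
               subF (lift (a /0)) (wkF₁ φ) ≡ φ
lift-/0-wkF₁ a φ =
  trans (subF-fuse {ν = lift var} (lift-fuse (λ _ → refl)) φ)
        (subF-id (lift-id (λ _ → refl)) φ)

lift-succ0-wkF₁ : ∀ {n} (φ : Formula (suc n)) →
                  subF (lift succ0) (wkF₁ φ) ≡ wkF₁ φ
lift-succ0-wkF₁ = subF-fuse (lift-fuse (λ _ → refl))

v0-/0-wkF₁ : ∀ {n} (φ : Formula (suc n)) → subF (var zero /0) (wkF₁ φ) ≡ φ
v0-/0-wkF₁ φ =
  trans (subF-fuse {ν = var} (λ { zero → refl ; (suc i) → refl }) φ)
        (subF-id (λ _ → refl) φ)

wkT-/0-wkF₁ : ∀ {n} (b : Term n) (φ : Formula (suc n)) →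
              subF (wkT b /0) (wkF₁ φ) ≡ wkF (subF (b /0) φ)
wkT-/0-wkF₁ b φ =
  trans (subF-fuse {ν = ν} (λ { zero → refl ; (suc i) → refl }) φ)
        (sym (subF-fuse (λ { zero → refl ; (suc i) → refl }) φ))
  where
  ν : Sub _ _
  ν zero    = wkT b
  ν (suc i) = var (suc i)

variable
  m : ℕ
  Γ A B C A₁ A₂ B₁ B₂ : Formula m
  χ θ : Formula (suc m)
  a b c : Term m

v0 : ∀ {n} → Term (suc n)
v0 = var zero
v1 : ∀ {n} → Term (suc (suc n))
v1 = var (suc zero)
v2 : ∀ {n} → Term (suc (suc (suc n)))
v2 = var (suc (suc zero))
v3 : ∀ {n} → Term (suc (suc (suc (suc n))))
v3 = var (suc (suc (suc zero)))

infixl 7 _⊕_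
_⊕_ : ∀ {n} → Term n → Term n → Term n
x ⊕ y = app add (x ∷ y ∷ [])

-- The arguments are listed in context order: inst₂ a b sends var 1 to a
-- and var 0 to b.
inst₁ : Term m → Sub 1 m
inst₁ x zero = x

inst₂ : Term m → Term m → Sub 2 m
inst₂ x y zero       = y
inst₂ x y (suc zero) = x

inst₃ : Term m → Term m → Term m → Sub 3 m
inst₃ x y z zero             = z
inst₃ x y z (suc zero)       = y
inst₃ x y z (suc (suc zero)) = x

infixr 5 _⟫_
_⟫_ : Γ ⊢[ m ] A → A ⊢[ m ] B → Γ ⊢[ m ] B
p ⟫ q = cutR p q

∨-elim : Γ ⊢[ m ] A ∨ᶠ B → Γ ∧ᶠ A ⊢[ m ] C → Γ ∧ᶠ B ⊢[ m ] C → Γ ⊢[ m ] C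
∨-elim p q r = ∧R idR p ⟫ dist ⟫ ∨L q r

∨-comm : A ∨ᶠ B ⊢[ m ] B ∨ᶠ A
∨-comm = ∨L ∨R₂ ∨R₁

∧-comm : A ∧ᶠ B ⊢[ m ] B ∧ᶠ A
∧-comm = ∧R ∧L₂ ∧L₁

∃-elim : Γ ⊢[ m ] ∃ᶠ χ → wkF Γ ∧ᶠ χ ⊢[ suc m ] wkF C → Γ ⊢[ m ] C
∃-elim p q = ∧R idR p ⟫ frob ⟫ ∃-up q

∃-intro : (χ : Formula (suc m)) (t : Term m) → Γ ⊢[ m ] subF (t /0) χ → Γ ⊢[ m ] ∃ᶠ χ
∃-intro χ t p =
  p ⟫ subst (Der _ (subF (t /0) χ)) (/0-wkF t (∃ᶠ χ))
            (substR (t /0) (∃-down {φ = χ} idR))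

∃-mono : χ ⊢[ suc m ] θ → ∃ᶠ χ ⊢[ m ] ∃ᶠ θ
∃-mono {θ = θ} p = ∃-up (p ⟫ ∃-down {φ = θ} idR)

≐-refl : (x : Term m) → Γ ⊢[ m ] x ≐ x
≐-refl x = ⊤R ⟫ substR (inst₁ x) eq-refl

≐-sym : Γ ⊢[ m ] a ≐ b → Γ ⊢[ m ] b ≐ a
≐-sym {a = a} {b = b} p = p ⟫ substR (inst₂ a b) generic
  where
  generic : (v1 ≐ v0) ⊢[ 2 ] (v0 ≐ v1)
  generic = ∧R idR (≐-refl v1) ⟫ eq-subst (v0 ≐ v2) v1 v0

≐-trans : Γ ⊢[ m ] a ≐ b → Γ ⊢[ m ] b ≐ c → Γ ⊢[ m ] a ≐ c
≐-trans {a = a} {b = b} {c = c} p q = ∧R p q ⟫ substR (inst₃ a b c) generic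
  where
  generic : (v2 ≐ v1) ∧ᶠ (v1 ≐ v0) ⊢[ 3 ] (v2 ≐ v0)
  generic = ∧R ∧L₂ ∧L₁ ⟫ eq-subst (v3 ≐ v0) v1 v0

S-cong : Γ ⊢[ m ] a ≐ b → Γ ⊢[ m ] S a ≐ S b
S-cong {a = a} {b = b} p = p ⟫ substR (inst₂ a b) generic
  where
  generic : (v1 ≐ v0) ⊢[ 2 ] (S v1 ≐ S v0)
  generic = ∧R idR (≐-refl (S v1)) ⟫ eq-subst (S v2 ≐ S v0) v1 v0

⊕-congˡ : Γ ⊢[ m ] a ≐ b → Γ ⊢[ m ] a ⊕ c ≐ b ⊕ c
⊕-congˡ {a = a} {b = b} {c = c} p = p ⟫ substR (inst₃ a b c) generic
  where
  generic : (v2 ≐ v1) ⊢[ 3 ] (v2 ⊕ v0 ≐ v1 ⊕ v0)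
  generic = ∧R idR (≐-refl (v2 ⊕ v0)) ⟫ eq-subst (v3 ⊕ v1 ≐ v0 ⊕ v1) v2 v1

⊕-congʳ : Γ ⊢[ m ] a ≐ b → Γ ⊢[ m ] c ⊕ a ≐ c ⊕ b
⊕-congʳ {a = a} {b = b} {c = c} p = p ⟫ substR (inst₃ a b c) generic
  where
  generic : (v2 ≐ v1) ⊢[ 3 ] (v0 ⊕ v2 ≐ v0 ⊕ v1)
  generic = ∧R idR (≐-refl (v0 ⊕ v2)) ⟫ eq-subst (v1 ⊕ v3 ≐ v1 ⊕ v0) v2 v1

<-respˡ-≐ : Γ ⊢[ m ] a ≐ b → Γ ⊢[ m ] a <ᶠ c → Γ ⊢[ m ] b <ᶠ c
<-respˡ-≐ {a = a} {b = b} {c = c} p q =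
  ∧R p q ⟫ substR (inst₃ a b c) (eq-subst (v0 <ᶠ v1) v2 v1)

<-respʳ-≐ : Γ ⊢[ m ] a ≐ b → Γ ⊢[ m ] c <ᶠ a → Γ ⊢[ m ] c <ᶠ b
<-respʳ-≐ {a = a} {b = b} {c = c} p q =
  ∧R p q ⟫ substR (inst₃ a b c) (eq-subst (v1 <ᶠ v0) v2 v1)

S-injective : Γ ⊢[ m ] S a ≐ S b → Γ ⊢[ m ] a ≐ b
S-injective {a = a} {b = b} p = p ⟫ substR (inst₂ a b) (axR ax-sinj)

S≢0 : Γ ⊢[ m ] S a ≐ 𝟎 → Γ ⊢[ m ] C
S≢0 {a = a} p = p ⟫ substR (inst₁ a) (axR ax-s0) ⟫ ⊥L

zero-or-suc : Γ ⊢[ m ] (a ≐ 𝟎) ∨ᶠ ∃ᶠ (wkT a ≐ S v0)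
zero-or-suc {a = a} = ⊤R ⟫ substR (inst₁ a) generic
  where
  generic : ⊤ᶠ ⊢[ 1 ] (v0 ≐ 𝟎) ∨ᶠ ∃ᶠ (v1 ≐ S v0)
  generic = IndR {0} {⊤ᶠ} {(v0 ≐ 𝟎) ∨ᶠ ∃ᶠ (v1 ≐ S v0)}
    (≐-refl 𝟎 ⟫ ∨R₁)
    (∃-intro (S v1 ≐ S v0) v0 (≐-refl (S v0)) ⟫ ∨R₂)

add-step : PR 3
add-step = Cn 𝗌 (π 3 (suc (suc zero)) ∷ [])

⊕-identityʳ : Γ ⊢[ m ] a ⊕ 𝟎 ≐ a
⊕-identityʳ {a = a} = ⊤R ⟫ substR (inst₁ a) generic
  where
  generic : ⊤ᶠ ⊢[ 1 ] (v0 ⊕ 𝟎 ≐ v0)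
  generic = ≐-trans (axR (ax-Pr0 1 (π 1 zero) add-step)) (axR (ax-π 1 zero))

⊕-suc : Γ ⊢[ m ] a ⊕ S b ≐ S (a ⊕ b)
⊕-suc {a = a} {b = b} = ⊤R ⟫ substR (inst₂ a b) generic
  where
  generic : ⊤ᶠ ⊢[ 2 ] (v1 ⊕ S v0 ≐ S (v1 ⊕ v0))
  generic = ≐-trans (axR (ax-PrS 1 (π 1 zero) add-step))
    (≐-trans (substR (inst₃ (v1 ⊕ v0) v0 v1) (axR (ax-Cn 3 𝗌 (π 3 (suc (suc zero)) ∷ []))))
             (S-cong (substR (inst₃ (v1 ⊕ v0) v0 v1) (axR (ax-π 3 (suc (suc zero)))))))

⊕-identityˡ : Γ ⊢[ m ] 𝟎 ⊕ a ≐ a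
⊕-identityˡ {a = a} = ⊤R ⟫ substR (inst₁ a) generic
  where
  generic : ⊤ᶠ ⊢[ 1 ] (𝟎 ⊕ v0 ≐ v0)
  generic = IndR {0} {⊤ᶠ} {𝟎 ⊕ v0 ≐ v0} ⊕-identityʳ (≐-trans ⊕-suc (S-cong ∧L₂))

suc-⊕ : Γ ⊢[ m ] S a ⊕ b ≐ S (a ⊕ b)
suc-⊕ {a = a} {b = b} = ⊤R ⟫ substR (inst₂ a b) generic
  where
  generic : ⊤ᶠ ⊢[ 2 ] (S v1 ⊕ v0 ≐ S (v1 ⊕ v0))
  generic = IndR {1} {⊤ᶠ} {S v1 ⊕ v0 ≐ S (v1 ⊕ v0)}
    (≐-trans ⊕-identityʳ (≐-sym (S-cong ⊕-identityʳ)))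
    (≐-trans ⊕-suc (≐-trans (S-cong ∧L₂) (S-cong (≐-sym ⊕-suc))))

⊕-assoc : Γ ⊢[ m ] (a ⊕ b) ⊕ c ≐ a ⊕ (b ⊕ c)
⊕-assoc {a = a} {b = b} {c = c} = ⊤R ⟫ substR (inst₃ a b c) generic
  where
  generic : ⊤ᶠ ⊢[ 3 ] ((v2 ⊕ v1) ⊕ v0 ≐ v2 ⊕ (v1 ⊕ v0))
  generic = IndR {2} {⊤ᶠ} {(v2 ⊕ v1) ⊕ v0 ≐ v2 ⊕ (v1 ⊕ v0)}
    (≐-trans ⊕-identityʳ (≐-sym (⊕-congʳ ⊕-identityʳ)))
    (≐-trans ⊕-suc (≐-trans (S-cong ∧L₂) (≐-trans (≐-sym ⊕-suc) (⊕-congʳ (≐-sym ⊕-suc)))))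

x⊕Sy≢x : Γ ⊢[ m ] a ⊕ S b ≐ a → Γ ⊢[ m ] C
x⊕Sy≢x {a = a} {b = b} p = p ⟫ substR (inst₂ b a) generic ⟫ ⊥L
  where
  generic : (v0 ⊕ S v1 ≐ v0) ⊢[ 2 ] ⊥ᶠ
  generic = IndL {1} {v0 ⊕ S v1 ≐ v0} {⊥ᶠ}
    (S≢0 (≐-trans (≐-sym ⊕-identityˡ) idR))
    (≐-trans ⊕-suc (≐-trans (≐-sym suc-⊕) (S-injective (≐-trans (≐-sym ⊕-suc) idR))) ⟫ ∨R₂)

<-intro : Γ ⊢[ m ] a ⊕ S c ≐ b → Γ ⊢[ m ] a <ᶠ b
<-intro {a = a} {c = c} {b = b} p = p ⟫ substR (inst₃ a b c) (∃-down (axR ax-⇐<))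

<-elim : Γ ⊢[ m ] a <ᶠ b → Γ ⊢[ m ] ∃ᶠ (wkT a ⊕ S v0 ≐ wkT b)
<-elim {a = a} {b = b} p = p ⟫ substR (inst₂ a b) (axR ax-<⇒)

<-irrefl : Γ ⊢[ m ] a <ᶠ a → Γ ⊢[ m ] C
<-irrefl {a = a} p = p ⟫ substR (inst₁ a) generic ⟫ ⊥L
  where
  generic : (v0 <ᶠ v0) ⊢[ 1 ] ⊥ᶠ
  generic = ∃-elim (<-elim idR) (x⊕Sy≢x ∧L₂)

<-asym : Γ ⊢[ m ] a <ᶠ b → Γ ⊢[ m ] b <ᶠ a → Γ ⊢[ m ] C
<-asym {a = a} {b = b} p q = ∧R p q ⟫ substR (inst₂ a b) generic ⟫ ⊥L
  where
  generic : (v1 <ᶠ v0) ∧ᶠ (v0 <ᶠ v1) ⊢[ 2 ] ⊥ᶠ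
  generic = ∃-elim (<-elim ∧L₁) (∃-elim (<-elim (∧L₁ ⟫ ∧L₂))
    (x⊕Sy≢x (≐-trans (⊕-congʳ (≐-sym ⊕-suc))
            (≐-trans (≐-sym ⊕-assoc) (≐-trans (⊕-congˡ (∧L₁ ⟫ ∧L₂)) ∧L₂)))))

≮0 : Γ ⊢[ m ] a <ᶠ 𝟎 → Γ ⊢[ m ] C
≮0 {a = a} p = p ⟫ substR (inst₁ a) generic ⟫ ⊥L
  where
  generic : (v0 <ᶠ 𝟎) ⊢[ 1 ] ⊥ᶠ
  generic = ∃-elim (<-elim idR) (S≢0 (≐-trans (≐-sym ⊕-suc) ∧L₂))

<-step : Γ ⊢[ m ] a <ᶠ b → Γ ⊢[ m ] a <ᶠ S b
<-step {a = a} {b = b} p = p ⟫ substR (inst₂ a b) generic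
  where
  generic : (v1 <ᶠ v0) ⊢[ 2 ] (v1 <ᶠ S v0)
  generic = ∃-elim (<-elim idR) (<-intro (≐-trans ⊕-suc (S-cong ∧L₂)))

x<Sx : Γ ⊢[ m ] a <ᶠ S a
x<Sx = <-intro (≐-trans ⊕-suc (S-cong ⊕-identityʳ))

⊕⇒<∨≐ : Γ ⊢[ m ] a ⊕ c ≐ b → Γ ⊢[ m ] (a <ᶠ b) ∨ᶠ (a ≐ b)
⊕⇒<∨≐ {a = a} {c = c} {b = b} p = p ⟫ substR (inst₃ a b c) generic
  where
  generic : (v2 ⊕ v0 ≐ v1) ⊢[ 3 ] (v2 <ᶠ v1) ∨ᶠ (v2 ≐ v1)
  generic = ∨-elim (zero-or-suc {a = v0})
    (≐-trans (≐-sym ⊕-identityʳ) (≐-trans (⊕-congʳ (≐-sym ∧L₂)) ∧L₁) ⟫ ∨R₂)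
    (∃-elim ∧L₂ (<-intro (≐-trans (⊕-congʳ (≐-sym ∧L₂)) (∧L₁ ⟫ ∧L₁)) ⟫ ∨R₁))

<S⇒<∨≐ : Γ ⊢[ m ] a <ᶠ S b → Γ ⊢[ m ] (a <ᶠ b) ∨ᶠ (a ≐ b)
<S⇒<∨≐ {a = a} {b = b} p = p ⟫ substR (inst₂ a b) generic
  where
  generic : (v1 <ᶠ S v0) ⊢[ 2 ] (v1 <ᶠ v0) ∨ᶠ (v1 ≐ v0)
  generic = ∃-elim (<-elim idR) (⊕⇒<∨≐ (S-injective (≐-trans (≐-sym ⊕-suc) ∧L₂)))

<⇒S<∨S≐ : Γ ⊢[ m ] a <ᶠ b → Γ ⊢[ m ] (S a <ᶠ b) ∨ᶠ (S a ≐ b)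
<⇒S<∨S≐ {a = a} {b = b} p = p ⟫ substR (inst₂ a b) generic
  where
  generic : (v1 <ᶠ v0) ⊢[ 2 ] (S v1 <ᶠ v0) ∨ᶠ (S v1 ≐ v0)
  generic = ∃-elim (<-elim idR) (⊕⇒<∨≐ (≐-trans suc-⊕ (≐-trans (≐-sym ⊕-suc) ∧L₂)))

<-trichotomy : Γ ⊢[ m ] (a <ᶠ b) ∨ᶠ ((a ≐ b) ∨ᶠ (b <ᶠ a))
<-trichotomy {a = a} {b = b} = ⊤R ⟫ substR (inst₂ a b) generic
  where
  generic : ⊤ᶠ ⊢[ 2 ] (v1 <ᶠ v0) ∨ᶠ ((v1 ≐ v0) ∨ᶠ (v0 <ᶠ v1))
  generic = IndR {1} {⊤ᶠ} {(v1 <ᶠ v0) ∨ᶠ ((v1 ≐ v0) ∨ᶠ (v0 <ᶠ v1))}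
    (∨-elim (zero-or-suc {a = v0}) (∧L₂ ⟫ ∨R₁ ⟫ ∨R₂)
       (∃-elim ∧L₂ (<-intro (≐-trans ⊕-identityˡ (≐-sym ∧L₂)) ⟫ ∨R₂ ⟫ ∨R₂)))
    (∧L₂ ⟫ ∨L (<-step idR ⟫ ∨R₁)
       (∨L (<-respˡ-≐ (≐-sym idR) x<Sx ⟫ ∨R₁)
           (<⇒S<∨S≐ idR ⟫ ∨L (∨R₂ ⟫ ∨R₂) (≐-sym idR ⟫ ∨R₁ ⟫ ∨R₂))))

∀<-zero : Γ ⊢[ m ] ∀<ᶠ 𝟎 χ
∀<-zero = ∀<-up (∧L₂ ⟫ ≮0 idR)

∀<-extend : ∀<ᶠ a χ ∧ᶠ subF (a /0) χ ⊢[ m ] ∀<ᶠ (S a) χ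
∀<-extend {a = a} {χ = χ} = ∀<-up (∨-elim (∧L₂ ⟫ <S⇒<∨≐ idR) below at)
  where
  below : _ ∧ᶠ (v0 <ᶠ wkT a) ⊢[ _ ] χ
  below = ∧R (∧L₁ ⟫ ∧L₁ ⟫ ∧L₁) ∧L₂ ⟫ ∀<-down {ψ = ∀<ᶠ a χ} idR
  replace : (wkT a ≐ v0) ∧ᶠ wkF (subF (a /0) χ) ⊢[ _ ] χ
  replace = subst₂ (λ X Y → Der _ ((wkT a ≐ v0) ∧ᶠ X) Y)
                   (wkT-/0-wkF₁ a χ) (v0-/0-wkF₁ χ)
                   (eq-subst (wkF₁ χ) (wkT a) v0)
  at : _ ∧ᶠ (v0 ≐ wkT a) ⊢[ _ ] χ
  at = ∧R (≐-sym ∧L₂) (∧L₁ ⟫ ∧L₁ ⟫ ∧L₂) ⟫ replace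

∃<-extend : ∃<ᶠ a χ ⊢[ m ] ∃<ᶠ (S a) χ
∃<-extend = ∃-mono (∧R (∧L₁ ⟫ <-step idR) ∧L₂)

∃<-intro : subF (a /0) χ ⊢[ m ] ∃<ᶠ (S a) χ
∃<-intro {a = a} {χ = χ} = ∃-intro ((v0 <ᶠ wkT (S a)) ∧ᶠ χ) a (∧R a<Sa idR)
  where
  a<Sa : subF (a /0) χ ⊢[ _ ] a <ᶠ subT (a /0) (wkT (S a))
  a<Sa = subst (λ t → Der _ (subF (a /0) χ) (a <ᶠ t)) (sym (/0-wkT a (S a))) x<Sx

∀<∧∃<-disjoint : χ ∧ᶠ θ ⊢[ suc m ] ⊥ᶠ → ∀<ᶠ a χ ∧ᶠ ∃<ᶠ a θ ⊢[ m ] ⊥ᶠ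
∀<∧∃<-disjoint {χ = χ} {a = a} dis =
  frob ⟫ ∃-up (∧R (∧R ∧L₁ (∧L₂ ⟫ ∧L₁) ⟫ ∀<-down {ψ = ∀<ᶠ a χ} idR) (∧L₂ ⟫ ∧L₂) ⟫ dis)

∀<∨∃<-exhaustive : ⊤ᶠ ⊢[ suc m ] χ ∨ᶠ θ → ⊤ᶠ ⊢[ m ] ∀<ᶠ a χ ∨ᶠ ∃<ᶠ a θ
∀<∨∃<-exhaustive {m} {χ} {θ} {a} exh =
  subst (Der m ⊤ᶠ) Inv-/0 (substR (a /0) (IndR {m} {⊤ᶠ} {Inv} (∀<-zero ⟫ ∨R₁) step))
  where
  -- The bound becomes the new variable var zero of the context.
  χ⁺ θ⁺ : Formula (suc (suc m))
  χ⁺ = wkF₁ χ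
  θ⁺ = wkF₁ θ
  Inv : Formula (suc m)
  Inv = ∀<ᶠ v0 χ⁺ ∨ᶠ ∃<ᶠ v0 θ⁺
  Inv-/0 : subF (a /0) Inv ≡ (∀<ᶠ a χ ∨ᶠ ∃<ᶠ a θ)
  Inv-/0 = cong₂ (λ X Y → ∀<ᶠ a X ∨ᶠ ∃<ᶠ a Y) (lift-/0-wkF₁ a χ) (lift-/0-wkF₁ a θ)
  Inv-succ0 : subF succ0 Inv ≡ (∀<ᶠ (S v0) χ⁺ ∨ᶠ ∃<ᶠ (S v0) θ⁺)
  Inv-succ0 =
    cong₂ (λ X Y → ∀<ᶠ (S v0) X ∨ᶠ ∃<ᶠ (S v0) Y) (lift-succ0-wkF₁ χ) (lift-succ0-wkF₁ θ)
  exh⁺ : ⊤ᶠ ⊢[ suc m ] subF (v0 /0) χ⁺ ∨ᶠ subF (v0 /0) θ⁺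
  exh⁺ = subst₂ (λ X Y → Der _ ⊤ᶠ (X ∨ᶠ Y)) (sym (v0-/0-wkF₁ χ)) (sym (v0-/0-wkF₁ θ)) exh
  extend : Inv ⊢[ suc m ] ∀<ᶠ (S v0) χ⁺ ∨ᶠ ∃<ᶠ (S v0) θ⁺
  extend = ∨L (∨-elim (⊤R ⟫ exh⁺) (∀<-extend ⟫ ∨R₁) (∧L₂ ⟫ ∃<-intro ⟫ ∨R₂))
            (∃<-extend ⟫ ∨R₂)
  step : ⊤ᶠ ∧ᶠ Inv ⊢[ suc m ] subF succ0 Inv
  step = subst (Der _ _) (sym Inv-succ0) (∧L₂ ⟫ extend)

record IsComplement {n : ℕ} (φ ψ : Formula n) : Set where
  field
    disjoint   : φ ∧ᶠ ψ ⊢[ n ] ⊥ᶠ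
    exhaustive : ⊤ᶠ ⊢[ n ] φ ∨ᶠ ψ

open IsComplement

IsComplement-sym : IsComplement A B → IsComplement B A
IsComplement-sym c = record
  { disjoint   = ∧-comm ⟫ disjoint c
  ; exhaustive = exhaustive c ⟫ ∨-comm
  }

⊤-⊥-complement : IsComplement {m} ⊤ᶠ ⊥ᶠ
⊤-⊥-complement = record { disjoint = ∧L₂ ; exhaustive = ∨R₁ }

≐-complement : IsComplement (a ≐ b) ((a <ᶠ b) ∨ᶠ (b <ᶠ a))
≐-complement = record
  { disjoint   = dist ⟫ ∨L (<-irrefl (<-respˡ-≐ ∧L₁ ∧L₂)) (<-irrefl (<-respʳ-≐ ∧L₁ ∧L₂))
  ; exhaustive = <-trichotomy ⟫ ∨L (∨R₁ ⟫ ∨R₂) (∨L ∨R₁ (∨R₂ ⟫ ∨R₂))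
  }

<-complement : IsComplement (a <ᶠ b) ((b <ᶠ a) ∨ᶠ (a ≐ b))
<-complement = record
  { disjoint   = dist ⟫ ∨L (<-asym ∧L₁ ∧L₂) (<-irrefl (<-respˡ-≐ ∧L₂ ∧L₁))
  ; exhaustive = <-trichotomy ⟫ ∨L ∨R₁ (∨L (∨R₂ ⟫ ∨R₂) (∨R₁ ⟫ ∨R₂))
  }

∧-complement : IsComplement A₁ B₁ → IsComplement A₂ B₂ →
               IsComplement (A₁ ∧ᶠ A₂) (B₁ ∨ᶠ B₂)
∧-complement c₁ c₂ = record
  { disjoint   = dist ⟫ ∨L (∧R (∧L₁ ⟫ ∧L₁) ∧L₂ ⟫ disjoint c₁)
                           (∧R (∧L₁ ⟫ ∧L₂) ∧L₂ ⟫ disjoint c₂)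
  ; exhaustive = ∨-elim (exhaustive c₁)
      (∨-elim (⊤R ⟫ exhaustive c₂) (∧R (∧L₁ ⟫ ∧L₂) ∧L₂ ⟫ ∨R₁) (∧L₂ ⟫ ∨R₂ ⟫ ∨R₂))
      (∧L₂ ⟫ ∨R₁ ⟫ ∨R₂)
  }

∨-complement : IsComplement A₁ B₁ → IsComplement A₂ B₂ →
               IsComplement (A₁ ∨ᶠ A₂) (B₁ ∧ᶠ B₂)
∨-complement c₁ c₂ =
  IsComplement-sym (∧-complement (IsComplement-sym c₁) (IsComplement-sym c₂))

∀<-complement : IsComplement χ θ → IsComplement (∀<ᶠ a χ) (∃<ᶠ a θ)
∀<-complement c = record
  { disjoint   = ∀<∧∃<-disjoint (disjoint c)
  ; exhaustive = ∀<∨∃<-exhaustive (exhaustive c)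
  }

∃<-complement : IsComplement χ θ → IsComplement (∃<ᶠ a χ) (∀<ᶠ a θ)
∃<-complement c = IsComplement-sym (∀<-complement (IsComplement-sym c))

Δ₀-complement : ∀ {n} {φ : Formula n} → Δ₀ φ → Σ[ ψ ∈ Formula n ] Δ₀ ψ × IsComplement φ ψ
Δ₀-complement ⊤Δ        = ⊥ᶠ , ⊥Δ , ⊤-⊥-complement
Δ₀-complement ⊥Δ        = ⊤ᶠ , ⊤Δ , IsComplement-sym ⊤-⊥-complement
Δ₀-complement (≐Δ t u)  = ((t <ᶠ u) ∨ᶠ (u <ᶠ t)) , ∨Δ (<Δ t u) (<Δ u t) , ≐-complement
Δ₀-complement (<Δ t u)  = ((u <ᶠ t) ∨ᶠ (t ≐ u)) , ∨Δ (<Δ u t) (≐Δ t u) , <-complement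
Δ₀-complement (∧Δ d₁ d₂) with Δ₀-complement d₁ | Δ₀-complement d₂
... | ψ₁ , e₁ , c₁ | ψ₂ , e₂ , c₂ = (ψ₁ ∨ᶠ ψ₂) , ∨Δ e₁ e₂ , ∧-complement c₁ c₂
Δ₀-complement (∨Δ d₁ d₂) with Δ₀-complement d₁ | Δ₀-complement d₂
... | ψ₁ , e₁ , c₁ | ψ₂ , e₂ , c₂ = (ψ₁ ∧ᶠ ψ₂) , ∧Δ e₁ e₂ , ∨-complement c₁ c₂
Δ₀-complement (∃<Δ t d) with Δ₀-complement d
... | ψ , e , c = ∀<ᶠ t ψ , ∀<Δ t e , ∃<-complement c
Δ₀-complement (∀<Δ t d) with Δ₀-complement d
... | ψ , e , c = ∃<ᶠ t ψ , ∃<Δ t e , ∀<-complement c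

lemma6p3 : ∀ {n : ℕ} (φ : Formula n) → Δ₀ φ →
    Σ (Formula n) (λ ψ → Δ₀ ψ × (φ ∧ᶠ ψ ⊢[ n ] ⊥ᶠ) × (⊤ᶠ ⊢[ n ] φ ∨ᶠ ψ))
lemma6p3 _ d with Δ₀-complement d
... | ψ , e , c = ψ , e , disjoint c , exhaustive c
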